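{- Let $X = X_1 \uplus X_2$ be a finite set of products partitioned into two levels, with utilities $u(x) > 0$, a no-purchase utility $u_0 > 0$, and revenues $r(x) \ge 0$. Let $S^*$ be any optimal assortment under the Sequential Multinomial Logit model, $R^* = R(S^*) = \max_{S \subseteq X} R(S)$, and $S_i^* = S^* \cap X_i$. If $i \in \{1,2\}$ and $Z$ is a nonempty subset of $S_i^*$, then $\alpha(Z) \ge R^*$.
   Context: For $S \subseteq X$ write $S_i = S \cap X_i$ ($i=1,2$), $U(S) = \sum_{x \in S} u(x)$, and for nonempty $S$, $\alpha(S) = \frac{\sum_{x \in S} u(x) r(x)}{U(S)}$. The Sequential Multinomial Logit (SML) model gives, for an offered assortment $S \subseteq X$, choice probabilities $\rho(x,S) = \frac{u(x)}{U(S)+u_0}$ if $x \in S_1$, and $\rho(x,S) = \left(1 - \frac{U(S_1)}{U(S)+u_0}\right)\frac{u(x)}{U(S)+u_0}$ if $x \in S_2$. The expected revenue is $R(S) = \sum_{x \in S} \rho(x,S) r(x)$.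
   Formalization: The utilities $u(x)$, the no-purchase utility $u_0$ and the revenues $r(x)$ are rational numbers rather than real numbers. -}

module Defs where

open import Data.Nat using (ℕ; zero; suc)
open import Data.Fin using (Fin; zero; suc)
open import Data.Fin.Subset using (Subset; Side; inside; outside)
open import Data.Vec using (lookup)
import Data.Vec
open import Data.Rational using (ℚ; 0ℚ; 1ℚ; _+_; _*_; _-_; _÷_; ≢-nonZero)
open import Data.Rational.Properties using (_≟_)
open import Relation.Nullary using (yes; no)

data Lvl : Set where
  L1 L2 : Lvl

sumFin : (n : ℕ) → (Fin n → ℚ) → ℚ
sumFin zero    f = 0ℚ
sumFin (suc n) f = f zero + sumFin n (λ i → f (suc i))

sumOver : {n : ℕ} → Subset n → (Fin n → ℚ) → ℚ
sumOver {n} S f = sumFin n (λ i → sel (lookup S i) i)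
  where
  sel : Side → Fin n → ℚ
  sel inside  i = f i
  sel outside i = 0ℚ

-- Total division (q ÷' 0 = 0); only ever applied to positive denominators here.
_÷'_ : ℚ → ℚ → ℚ
p ÷' q with q ≟ 0ℚ
... | yes _  = 0ℚ
... | no q≢0 = _÷_ p q {{≢-nonZero q≢0}}

restrict : {n : ℕ} → (Fin n → Lvl) → Lvl → Subset n → Subset n
restrict {n} lev ℓ S = Data.Vec.tabulate (λ i → keep (lev i) ℓ (lookup S i))
  where
  keep : Lvl → Lvl → Side → Side
  keep L1 L1 s = s
  keep L2 L2 s = s
  keep L1 L2 s = outside
  keep L2 L1 s = outside

U : {n : ℕ} → (Fin n → ℚ) → Subset n → ℚ
U u S = sumOver S u

α : {n : ℕ} → (Fin n → ℚ) → (Fin n → ℚ) → Subset n → ℚ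
α u r S = sumOver S (λ x → u x * r x) ÷' U u S

ρ : {n : ℕ} → (Fin n → Lvl) → (Fin n → ℚ) → ℚ → Subset n → Fin n → ℚ
ρ lev u u0 S x with lev x
... | L1 = u x ÷' (U u S + u0)
... | L2 = (1ℚ - (U u (restrict lev L1 S) ÷' (U u S + u0))) * (u x ÷' (U u S + u0))

R : {n : ℕ} → (Fin n → Lvl) → (Fin n → ℚ) → ℚ → (Fin n → ℚ) → Subset n → ℚ
R lev u u0 r S = sumOver S (λ x → ρ lev u u0 S x * r x)

{-# OPTIONS --safe #-}
-- Write X_ℓ = U(S_ℓ), A_ℓ = Σ_{x ∈ S_ℓ} u(x) r(x) and D = X₁ + X₂ + u₀, so that
-- R(S) = A₁/D + (1 − X₁/D) A₂/D.  Removing a subset Z of S*_ℓ from S* lowers X_ℓ by U(Z)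
-- and A_ℓ by Σ_Z u r, leaves the other level alone, and cannot increase the revenue.
-- Clearing denominators, (Σ_Z u r − R* U(Z)) times a positive factor equals a nonnegative
-- multiple of R* − R(S* ∖ Z) plus a term that is nonnegative: for ℓ = 1 it is (X₂ + u₀) A₂ U(Z),
-- for ℓ = 2 a nonnegative multiple of A₁ − R* X₁, nonnegative by the case ℓ = 1 with Z = S*₁.
-- Dividing by U(Z) > 0 gives α(Z) ≥ R*.
module Submission where

open import Defs
open import Data.Nat using (ℕ; zero; suc)
open import Data.Fin using (Fin; zero; suc)
open import Data.Fin.Subset using (Subset; Side; inside; outside; _⊆_; _─_; Nonempty)
open import Data.Rational using (ℚ; 0ℚ; 1ℚ; _+_; _*_; _-_; -_; 1/_; _<_; _≤_; NonZero; positive; nonNegative; ≢-nonZero)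

open import Algebra.Bundles using (CommutativeRing)
open import Data.Bool using (not; _∧_)
open import Data.Empty using (⊥-elim)
open import Data.List using ([]; _∷_)
open import Data.Product using (_,_)
open import Data.Rational.Properties
open import Data.Vec using (lookup; tabulate)
import Data.Vec as Vec
open import Data.Vec.Properties using (lookup⇒[]=; []=⇒lookup; tabulate∘lookup; tabulate-cong)
open import Function using (_∘_)
open import Level using (0ℓ)
open import Relation.Binary.PropositionalEquality
open import Relation.Nullary using (yes; no)
open import Relation.Nullary.Decidable using (dec⇒maybe)
open import Tactic.RingSolver using (solve)
open import Tactic.RingSolver.Core.AlmostCommutativeRing using (AlmostCommutativeRing; fromCommutativeRing)
open import Algebra.Properties.Semiring.Sum (CommutativeRing.semiring +-*-commutativeRing)
  using (sum; sum-cong-≗; ∑-distrib-+; *-distribˡ-sum)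

open ≡-Reasoning

ℚ-ring : AlmostCommutativeRing 0ℓ 0ℓ
ℚ-ring = fromCommutativeRing +-*-commutativeRing (λ q → dec⇒maybe (0ℚ ≟ q))

linear-combination : ∀ {x y l r : ℚ} (k : ℚ) → l ≡ r → x ≡ y + k * (l - r) → x ≡ y
linear-combination {y = y} {l} k refl x≡ = trans x≡ (solve (y ∷ k ∷ l ∷ []) ℚ-ring)

0≤* : ∀ {p q} → 0ℚ ≤ p → 0ℚ ≤ q → 0ℚ ≤ p * q
0≤* {p} {q} 0≤p 0≤q = nonNegative⁻¹ (p * q) {{nonNeg*nonNeg⇒nonNeg p {{nonNegative 0≤p}} q {{nonNegative 0≤q}}}}

0<* : ∀ {p q} → 0ℚ < p → 0ℚ < q → 0ℚ < p * q
0<* {p} {q} 0<p 0<q = positive⁻¹ (p * q) {{pos*pos⇒pos p {{positive 0<p}} q {{positive 0<q}}}}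

p≤q⇒0≤q-p : ∀ {p q} → p ≤ q → 0ℚ ≤ q - p
p≤q⇒0≤q-p {p} {q} p≤q = subst (_≤ q - p) (+-inverseʳ p) (+-monoˡ-≤ (- p) p≤q)

≤-by-pos-multiple : ∀ {k p q} → 0ℚ < k → 0ℚ ≤ k * (q - p) → p ≤ q
≤-by-pos-multiple {k} {p} {q} 0<k 0≤k[q-p] =
  subst₂ _≤_ (+-identityʳ p) p+[q-p]≡q (+-monoʳ-≤ p 0≤q-p)
  where
  p+[q-p]≡q : p + (q - p) ≡ q
  p+[q-p]≡q = solve (p ∷ q ∷ []) ℚ-ring
  0≤q-p : 0ℚ ≤ q - p
  0≤q-p = *-cancelˡ-≤-pos k {{positive 0<k}} (subst (_≤ k * (q - p)) (sym (*-zeroʳ k)) 0≤k[q-p])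

÷'-as-* : ∀ p q → p ÷' q ≡ p * (1ℚ ÷' q)
÷'-as-* p q with q ≟ 0ℚ
... | yes _ = sym (*-zeroʳ p)
... | no _  = cong (p *_) (sym (*-identityˡ _))

÷'-inverseˡ : ∀ {q} → q ≢ 0ℚ → (1ℚ ÷' q) * q ≡ 1ℚ
÷'-inverseˡ {q} q≢0 with q ≟ 0ℚ
... | yes q≡0 = ⊥-elim (q≢0 q≡0)
... | no _    = trans (cong (_* q) (*-identityˡ (1/ q))) (*-inverseˡ q)
  where
  instance
    q-nonZero : NonZero q
    q-nonZero = ≢-nonZero q≢0

÷'-*-comm : ∀ p q s → (p ÷' q) * s ≡ (p * s) ÷' q
÷'-*-comm p q s = begin
  (p ÷' q) * s        ≡⟨ cong (_* s) (÷'-as-* p q) ⟩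
  p * (1ℚ ÷' q) * s   ≡⟨ *-assoc p _ s ⟩
  p * ((1ℚ ÷' q) * s) ≡⟨ cong (p *_) (*-comm _ s) ⟩
  p * (s * (1ℚ ÷' q)) ≡⟨ *-assoc p s _ ⟨
  p * s * (1ℚ ÷' q)   ≡⟨ ÷'-as-* (p * s) q ⟨
  (p * s) ÷' q        ∎

÷'-*-cancel : ∀ {q} p → q ≢ 0ℚ → (p ÷' q) * q ≡ p
÷'-*-cancel {q} p q≢0 = begin
  (p ÷' q) * q        ≡⟨ cong (_* q) (÷'-as-* p q) ⟩
  p * (1ℚ ÷' q) * q   ≡⟨ *-assoc p _ q ⟩
  p * ((1ℚ ÷' q) * q) ≡⟨ cong (p *_) (÷'-inverseˡ q≢0) ⟩
  p * 1ℚ              ≡⟨ *-identityʳ p ⟩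
  p                   ∎

≤-÷' : ∀ {p q s} → 0ℚ < q → p * q ≤ s → p ≤ s ÷' q
≤-÷' {p} {q} {s} 0<q pq≤s =
  *-cancelʳ-≤-pos q {{positive 0<q}} (subst (p * q ≤_) (sym (÷'-*-cancel s (≢-sym (<⇒≢ 0<q)))) pq≤s)

select : Side → ℚ → ℚ
select inside  q = q
select outside q = 0ℚ

sumFin≡sum : ∀ n (f : Fin n → ℚ) → sumFin n f ≡ sum f
sumFin≡sum zero    f = refl
sumFin≡sum (suc n) f = cong (f zero +_) (sumFin≡sum n (f ∘ suc))

-- The summand of Defs.sumOver is local to its where-block and cannot be named, so the
-- statement of summand≡select is inferred from its use in sumOver-as-sum.
mutual
  sumOver-as-sum : ∀ {n} (S : Subset n) f → sumOver S f ≡ sum (λ i → select (lookup S i) (f i))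
  sumOver-as-sum {n} S f = trans (sumFin≡sum n _) (sum-cong-≗ (summand≡select S f))

  summand≡select : ∀ {n} (S : Subset n) (f : Fin n → ℚ) i → _ ≡ select (lookup S i) (f i)
  summand≡select S f i with lookup S i
  ... | inside  = refl
  ... | outside = refl

sum-nonNeg : ∀ {n} {f : Fin n → ℚ} → (∀ i → 0ℚ ≤ f i) → 0ℚ ≤ sum f
sum-nonNeg {zero}  0≤f = ≤-refl
sum-nonNeg {suc n} 0≤f = +-mono-≤ (0≤f zero) (sum-nonNeg (0≤f ∘ suc))

sum-pos : ∀ {n} {f : Fin n → ℚ} → (∀ i → 0ℚ ≤ f i) → ∀ i → 0ℚ < f i → 0ℚ < sum f
sum-pos {suc n} 0≤f zero    0<fi = +-mono-<-≤ 0<fi (sum-nonNeg (0≤f ∘ suc))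
sum-pos {suc n} 0≤f (suc i) 0<fi = +-mono-≤-< (0≤f zero) (sum-pos (0≤f ∘ suc) i 0<fi)

select-*ˡ : ∀ s k q → select s (k * q) ≡ k * select s q
select-*ˡ inside  k q = refl
select-*ˡ outside k q = sym (*-zeroʳ k)

select-nonNeg : ∀ s {q} → 0ℚ ≤ q → 0ℚ ≤ select s q
select-nonNeg inside  0≤q = 0≤q
select-nonNeg outside 0≤q = ≤-refl

module _ {n} (S : Subset n) where

  sumOver-cong : ∀ {f g : Fin n → ℚ} → (∀ x → f x ≡ g x) → sumOver S f ≡ sumOver S g
  sumOver-cong {f} {g} f≗g = begin
    sumOver S f                           ≡⟨ sumOver-as-sum S f ⟩
    sum (λ i → select (lookup S i) (f i)) ≡⟨ sum-cong-≗ (λ i → cong (select (lookup S i)) (f≗g i)) ⟩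
    sum (λ i → select (lookup S i) (g i)) ≡⟨ sumOver-as-sum S g ⟨
    sumOver S g                           ∎

  sumOver-*ˡ : ∀ k (f : Fin n → ℚ) → sumOver S (λ x → k * f x) ≡ k * sumOver S f
  sumOver-*ˡ k f = begin
    sumOver S (λ x → k * f x)                   ≡⟨ sumOver-as-sum S _ ⟩
    sum (λ i → select (lookup S i) (k * f i))   ≡⟨ sum-cong-≗ (λ i → select-*ˡ (lookup S i) k (f i)) ⟩
    sum (λ i → k * select (lookup S i) (f i))   ≡⟨ *-distribˡ-sum k (λ i → select (lookup S i) (f i)) ⟨
    k * sum (λ i → select (lookup S i) (f i))   ≡⟨ cong (k *_) (sumOver-as-sum S f) ⟨
    k * sumOver S f                             ∎

  sumOver-÷' : ∀ q (f : Fin n → ℚ) → sumOver S (λ x → f x ÷' q) ≡ sumOver S f ÷' q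
  sumOver-÷' q f = begin
    sumOver S (λ x → f x ÷' q)          ≡⟨ sumOver-cong (λ x → trans (÷'-as-* (f x) q) (*-comm (f x) _)) ⟩
    sumOver S (λ x → (1ℚ ÷' q) * f x)   ≡⟨ sumOver-*ˡ (1ℚ ÷' q) f ⟩
    (1ℚ ÷' q) * sumOver S f             ≡⟨ *-comm _ (sumOver S f) ⟩
    sumOver S f * (1ℚ ÷' q)             ≡⟨ ÷'-as-* (sumOver S f) q ⟨
    sumOver S f ÷' q                    ∎

  sumOver-nonNeg : ∀ {f : Fin n → ℚ} → (∀ x → 0ℚ ≤ f x) → 0ℚ ≤ sumOver S f
  sumOver-nonNeg {f} 0≤f =
    subst (0ℚ ≤_) (sym (sumOver-as-sum S f)) (sum-nonNeg (λ i → select-nonNeg (lookup S i) (0≤f i)))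

  sumOver-pos : ∀ {f : Fin n → ℚ} → (∀ x → 0ℚ < f x) → Nonempty S → 0ℚ < sumOver S f
  sumOver-pos {f} 0<f (x , x∈S) =
    subst (0ℚ <_) (sym (sumOver-as-sum S f))
      (sum-pos (λ i → select-nonNeg (lookup S i) (<⇒≤ (0<f i))) x
        (subst (λ s → 0ℚ < select s (f x)) (sym ([]=⇒lookup x∈S)) (0<f x)))

keepOn : Lvl → Lvl → Side → Side
keepOn L1 L1 s = s
keepOn L2 L2 s = s
keepOn L1 L2 s = outside
keepOn L2 L1 s = outside

lookup-restrict : ∀ {n} (lev : Fin n → Lvl) ℓ (S : Subset n) i →
  lookup (restrict lev ℓ S) i ≡ keepOn (lev i) ℓ (lookup S i)
lookup-restrict lev L1 (s Vec.∷ S) zero with lev zero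
... | L1 = refl
... | L2 = refl
lookup-restrict lev L2 (s Vec.∷ S) zero with lev zero
... | L1 = refl
... | L2 = refl
lookup-restrict lev ℓ (s Vec.∷ S) (suc i) = lookup-restrict (lev ∘ suc) ℓ S i

lookup-─ : ∀ {n} (A Z : Subset n) i → lookup (A ─ Z) i ≡ not (lookup Z i) ∧ lookup A i
lookup-─ (a Vec.∷ A) (inside  Vec.∷ Z) zero    = refl
lookup-─ (a Vec.∷ A) (outside Vec.∷ Z) zero    = refl
lookup-─ (a Vec.∷ A) (z       Vec.∷ Z) (suc i) = lookup-─ A Z i

lookup-⊆ : ∀ {n} {Z A : Subset n} → Z ⊆ A → ∀ i → lookup Z i ≡ inside → lookup A i ≡ inside
lookup-⊆ {Z = Z} Z⊆A i Zᵢ≡inside = []=⇒lookup (Z⊆A (lookup⇒[]= i Z Zᵢ≡inside))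

≡-by-lookup : ∀ {n} {xs ys : Subset n} → (∀ i → lookup xs i ≡ lookup ys i) → xs ≡ ys
≡-by-lookup {xs = xs} {ys} xs≗ys = begin
  xs                   ≡⟨ tabulate∘lookup xs ⟨
  tabulate (lookup xs) ≡⟨ tabulate-cong xs≗ys ⟩
  tabulate (lookup ys) ≡⟨ tabulate∘lookup ys ⟩
  ys                   ∎

select-by-level : ∀ l s (h : Lvl → ℚ) → select s (h l) ≡ select (keepOn l L1 s) (h L1) + select (keepOn l L2 s) (h L2)
select-by-level L1 s h = sym (+-identityʳ _)
select-by-level L2 s h = sym (+-identityˡ _)

select-─ : ∀ a z q → (z ≡ inside → a ≡ inside) → select a q ≡ select (not z ∧ a) q + select z q
select-─ a       outside q _   = sym (+-identityʳ _)
select-─ inside  inside  q _   = sym (+-identityˡ q)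
select-─ outside inside  q z⇒a with () ← z⇒a refl

keepOn-─ : ∀ l ℓ z s → keepOn l ℓ (not z ∧ s) ≡ not z ∧ keepOn l ℓ s
keepOn-─ l  ℓ  outside s = refl
keepOn-─ L1 L1 inside  s = refl
keepOn-─ L1 L2 inside  s = refl
keepOn-─ L2 L1 inside  s = refl
keepOn-─ L2 L2 inside  s = refl

keepOn-─-other : ∀ l ℓ ℓ' z s → ℓ' ≢ ℓ → (z ≡ inside → keepOn l ℓ s ≡ inside) →
  keepOn l ℓ' (not z ∧ s) ≡ keepOn l ℓ' s
keepOn-─-other l  ℓ  ℓ' outside s _    _   = refl
keepOn-─-other L1 L1 L1 inside  s ℓ'≢ℓ _   = ⊥-elim (ℓ'≢ℓ refl)
keepOn-─-other L1 L1 L2 inside  s _    _   = refl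
keepOn-─-other L2 L2 L1 inside  s _    _   = refl
keepOn-─-other L2 L2 L2 inside  s ℓ'≢ℓ _   = ⊥-elim (ℓ'≢ℓ refl)
keepOn-─-other L1 L2 ℓ' inside  s _    z⇒s with () ← z⇒s refl
keepOn-─-other L2 L1 ℓ' inside  s _    z⇒s with () ← z⇒s refl

sumOver-split : ∀ {n} (A B C : Subset n) {f g h : Fin n → ℚ} →
  (∀ i → select (lookup A i) (f i) ≡ select (lookup B i) (g i) + select (lookup C i) (h i)) →
  sumOver A f ≡ sumOver B g + sumOver C h
sumOver-split A B C {f} {g} {h} split = begin
  sumOver A f
    ≡⟨ sumOver-as-sum A f ⟩
  sum (λ i → select (lookup A i) (f i))
    ≡⟨ sum-cong-≗ split ⟩
  sum (λ i → select (lookup B i) (g i) + select (lookup C i) (h i))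
    ≡⟨ ∑-distrib-+ (λ i → select (lookup B i) (g i)) (λ i → select (lookup C i) (h i)) ⟩
  sum (λ i → select (lookup B i) (g i)) + sum (λ i → select (lookup C i) (h i))
    ≡⟨ cong₂ _+_ (sumOver-as-sum B g) (sumOver-as-sum C h) ⟨
  sumOver B g + sumOver C h ∎

sumOver-─ : ∀ {n} {A Z : Subset n} (f : Fin n → ℚ) → Z ⊆ A → sumOver A f ≡ sumOver (A ─ Z) f + sumOver Z f
sumOver-─ {A = A} {Z} f Z⊆A = sumOver-split A (A ─ Z) Z split
  where
  split : ∀ i → select (lookup A i) (f i) ≡ select (lookup (A ─ Z) i) (f i) + select (lookup Z i) (f i)
  split i rewrite lookup-─ A Z i = select-─ (lookup A i) (lookup Z i) (f i) (lookup-⊆ Z⊆A i)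

module _ {n} (lev : Fin n → Lvl) where

  sumOver-by-level : ∀ (S : Subset n) (h : Lvl → Fin n → ℚ) →
    sumOver S (λ x → h (lev x) x) ≡ sumOver (restrict lev L1 S) (h L1) + sumOver (restrict lev L2 S) (h L2)
  sumOver-by-level S h = sumOver-split S (restrict lev L1 S) (restrict lev L2 S) split
    where
    split : ∀ i → select (lookup S i) (h (lev i) i)
                ≡ select (lookup (restrict lev L1 S) i) (h L1 i) + select (lookup (restrict lev L2 S) i) (h L2 i)
    split i rewrite lookup-restrict lev L1 S i | lookup-restrict lev L2 S i =
      select-by-level (lev i) (lookup S i) (λ ℓ → h ℓ i)

  restrict-─ : ∀ ℓ (S Z : Subset n) → restrict lev ℓ (S ─ Z) ≡ restrict lev ℓ S ─ Z
  restrict-─ ℓ S Z = ≡-by-lookup λ i → begin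
    lookup (restrict lev ℓ (S ─ Z)) i                ≡⟨ lookup-restrict lev ℓ (S ─ Z) i ⟩
    keepOn (lev i) ℓ (lookup (S ─ Z) i)              ≡⟨ cong (keepOn (lev i) ℓ) (lookup-─ S Z i) ⟩
    keepOn (lev i) ℓ (not (lookup Z i) ∧ lookup S i) ≡⟨ keepOn-─ (lev i) ℓ (lookup Z i) (lookup S i) ⟩
    not (lookup Z i) ∧ keepOn (lev i) ℓ (lookup S i) ≡⟨ cong (not (lookup Z i) ∧_) (lookup-restrict lev ℓ S i) ⟨
    not (lookup Z i) ∧ lookup (restrict lev ℓ S) i   ≡⟨ lookup-─ (restrict lev ℓ S) Z i ⟨
    lookup (restrict lev ℓ S ─ Z) i                  ∎

  restrict-─-other : ∀ {ℓ ℓ'} (S : Subset n) {Z} → ℓ' ≢ ℓ → Z ⊆ restrict lev ℓ S →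
    restrict lev ℓ' (S ─ Z) ≡ restrict lev ℓ' S
  restrict-─-other {ℓ} {ℓ'} S {Z} ℓ'≢ℓ Z⊆Sℓ = ≡-by-lookup λ i → begin
    lookup (restrict lev ℓ' (S ─ Z)) i                ≡⟨ lookup-restrict lev ℓ' (S ─ Z) i ⟩
    keepOn (lev i) ℓ' (lookup (S ─ Z) i)              ≡⟨ cong (keepOn (lev i) ℓ') (lookup-─ S Z i) ⟩
    keepOn (lev i) ℓ' (not (lookup Z i) ∧ lookup S i) ≡⟨ keepOn-─-other (lev i) ℓ ℓ' (lookup Z i) (lookup S i) ℓ'≢ℓ
                                                            (λ Zᵢ → trans (sym (lookup-restrict lev ℓ S i)) (lookup-⊆ Z⊆Sℓ i Zᵢ)) ⟩
    keepOn (lev i) ℓ' (lookup S i)                    ≡⟨ lookup-restrict lev ℓ' S i ⟨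
    lookup (restrict lev ℓ' S) i                      ∎

  sumOver-restrict-─ : ∀ {ℓ} (S : Subset n) {Z} (f : Fin n → ℚ) → Z ⊆ restrict lev ℓ S →
    sumOver (restrict lev ℓ S) f ≡ sumOver (restrict lev ℓ (S ─ Z)) f + sumOver Z f
  sumOver-restrict-─ {ℓ} S {Z} f Z⊆Sℓ = begin
    sumOver (restrict lev ℓ S) f                       ≡⟨ sumOver-─ f Z⊆Sℓ ⟩
    sumOver (restrict lev ℓ S ─ Z) f + sumOver Z f     ≡⟨ cong (λ A → sumOver A f + sumOver Z f) (restrict-─ ℓ S Z) ⟨
    sumOver (restrict lev ℓ (S ─ Z)) f + sumOver Z f   ∎

revenue : (u0 X₁ A₁ X₂ A₂ : ℚ) → ℚ
revenue u0 X₁ A₁ X₂ A₂ = let D = X₁ + X₂ + u0 in A₁ ÷' D + (1ℚ - X₁ ÷' D) * (A₂ ÷' D)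

clear-denominator : ∀ u0 X₁ A₁ X₂ A₂ i → let D = X₁ + X₂ + u0 in i * D ≡ 1ℚ →
  (A₁ * i + (1ℚ - X₁ * i) * (A₂ * i)) * (D * D) ≡ A₁ * D + (X₂ + u0) * A₂
clear-denominator u0 X₁ A₁ X₂ A₂ i iD≡1 = let D = X₁ + X₂ + u0 in
  linear-combination (A₁ * D + A₂ * D - X₁ * A₂ * (i * D + 1ℚ)) iD≡1
    (solve (u0 ∷ X₁ ∷ A₁ ∷ X₂ ∷ A₂ ∷ i ∷ []) ℚ-ring)

revenue-cleared : ∀ u0 X₁ A₁ X₂ A₂ → let D = X₁ + X₂ + u0 in 0ℚ < D →
  revenue u0 X₁ A₁ X₂ A₂ * (D * D) ≡ A₁ * D + (X₂ + u0) * A₂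
revenue-cleared u0 X₁ A₁ X₂ A₂ 0<D = begin
  revenue u0 X₁ A₁ X₂ A₂ * (D * D)
    ≡⟨ cong (_* (D * D)) (cong₂ _+_ (÷'-as-* A₁ D)
         (cong₂ (λ x a → (1ℚ - x) * a) (÷'-as-* X₁ D) (÷'-as-* A₂ D))) ⟩
  (A₁ * i + (1ℚ - X₁ * i) * (A₂ * i)) * (D * D)
    ≡⟨ clear-denominator u0 X₁ A₁ X₂ A₂ i (÷'-inverseˡ (≢-sym (<⇒≢ 0<D))) ⟩
  A₁ * D + (X₂ + u0) * A₂ ∎
  where
  D = X₁ + X₂ + u0
  i = 1ℚ ÷' D

removal-identity₁ : ∀ u0 Y₁ B₁ X₂ A₂ z a R R' →
  let D = Y₁ + z + X₂ + u0; D' = Y₁ + X₂ + u0 in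
  R  * (D  * D)  ≡ (B₁ + a) * D + (X₂ + u0) * A₂ →
  R' * (D' * D') ≡ B₁ * D' + (X₂ + u0) * A₂ →
  D * D' * (a - R * z) ≡ D * ((R - R') * (D' * D')) + (X₂ + u0) * A₂ * z
removal-identity₁ u0 Y₁ B₁ X₂ A₂ z a R R' eR eR' =
  let D = Y₁ + z + X₂ + u0; D' = Y₁ + X₂ + u0 in
  linear-combination D' (sym eR) (linear-combination D eR'
    (solve (u0 ∷ Y₁ ∷ B₁ ∷ X₂ ∷ A₂ ∷ z ∷ a ∷ R ∷ R' ∷ []) ℚ-ring))

removal-identity₂ : ∀ u0 X₁ A₁ Y₂ B₂ z a R R' →
  let D = X₁ + (Y₂ + z) + u0; D' = X₁ + Y₂ + u0; W = Y₂ + z + u0; W' = Y₂ + u0 in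
  R  * (D  * D)  ≡ A₁ * D  + W  * (B₂ + a) →
  R' * (D' * D') ≡ A₁ * D' + W' * B₂ →
  W * D * W' * (a - R * z) ≡ W * D * ((R - R') * (D' * D')) + z * X₁ * D * (A₁ - R * X₁)
removal-identity₂ u0 X₁ A₁ Y₂ B₂ z a R R' eR eR' =
  let D = X₁ + (Y₂ + z) + u0; D' = X₁ + Y₂ + u0; W = Y₂ + z + u0 in
  linear-combination (W * D' - z * X₁) (sym eR) (linear-combination (W * D) eR'
    (solve (u0 ∷ X₁ ∷ A₁ ∷ Y₂ ∷ B₂ ∷ z ∷ a ∷ R ∷ R' ∷ []) ℚ-ring))

revenue-removal₁ : ∀ {u0 Y₁ B₁ X₂ A₂ z a} →
  0ℚ < u0 → 0ℚ ≤ Y₁ → 0ℚ ≤ X₂ → 0ℚ ≤ A₂ → 0ℚ ≤ z →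
  revenue u0 Y₁ B₁ X₂ A₂ ≤ revenue u0 (Y₁ + z) (B₁ + a) X₂ A₂ →
  revenue u0 (Y₁ + z) (B₁ + a) X₂ A₂ * z ≤ a
revenue-removal₁ {u0} {Y₁} {B₁} {X₂} {A₂} {z} {a} 0<u0 0≤Y₁ 0≤X₂ 0≤A₂ 0≤z rev'≤rev =
  ≤-by-pos-multiple (0<* 0<D 0<D') (subst (0ℚ ≤_) (sym identity) 0≤gap)
  where
  D    = Y₁ + z + X₂ + u0
  D'   = Y₁ + X₂ + u0
  rev  = revenue u0 (Y₁ + z) (B₁ + a) X₂ A₂
  rev' = revenue u0 Y₁ B₁ X₂ A₂
  0<D : 0ℚ < D
  0<D = +-mono-≤-< (+-mono-≤ (+-mono-≤ 0≤Y₁ 0≤z) 0≤X₂) 0<u0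
  0<D' : 0ℚ < D'
  0<D' = +-mono-≤-< (+-mono-≤ 0≤Y₁ 0≤X₂) 0<u0
  identity : D * D' * (a - rev * z) ≡ D * ((rev - rev') * (D' * D')) + (X₂ + u0) * A₂ * z
  identity = removal-identity₁ u0 Y₁ B₁ X₂ A₂ z a rev rev'
    (revenue-cleared u0 (Y₁ + z) (B₁ + a) X₂ A₂ 0<D) (revenue-cleared u0 Y₁ B₁ X₂ A₂ 0<D')
  0≤gap : 0ℚ ≤ D * ((rev - rev') * (D' * D')) + (X₂ + u0) * A₂ * z
  0≤gap = +-mono-≤ (0≤* (<⇒≤ 0<D) (0≤* (p≤q⇒0≤q-p rev'≤rev) (0≤* (<⇒≤ 0<D') (<⇒≤ 0<D'))))
                   (0≤* (0≤* (+-mono-≤ 0≤X₂ (<⇒≤ 0<u0)) 0≤A₂) 0≤z)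

revenue-removal₂ : ∀ {u0 X₁ A₁ Y₂ B₂ z a} →
  0ℚ < u0 → 0ℚ ≤ X₁ → 0ℚ ≤ Y₂ → 0ℚ ≤ z →
  revenue u0 X₁ A₁ (Y₂ + z) (B₂ + a) * X₁ ≤ A₁ →
  revenue u0 X₁ A₁ Y₂ B₂ ≤ revenue u0 X₁ A₁ (Y₂ + z) (B₂ + a) →
  revenue u0 X₁ A₁ (Y₂ + z) (B₂ + a) * z ≤ a
revenue-removal₂ {u0} {X₁} {A₁} {Y₂} {B₂} {z} {a} 0<u0 0≤X₁ 0≤Y₂ 0≤z revX₁≤A₁ rev'≤rev =
  ≤-by-pos-multiple (0<* (0<* 0<W 0<D) 0<W') (subst (0ℚ ≤_) (sym identity) 0≤gap)
  where
  D    = X₁ + (Y₂ + z) + u0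
  D'   = X₁ + Y₂ + u0
  W    = Y₂ + z + u0
  W'   = Y₂ + u0
  rev  = revenue u0 X₁ A₁ (Y₂ + z) (B₂ + a)
  rev' = revenue u0 X₁ A₁ Y₂ B₂
  0<D : 0ℚ < D
  0<D = +-mono-≤-< (+-mono-≤ 0≤X₁ (+-mono-≤ 0≤Y₂ 0≤z)) 0<u0
  0<D' : 0ℚ < D'
  0<D' = +-mono-≤-< (+-mono-≤ 0≤X₁ 0≤Y₂) 0<u0
  0<W : 0ℚ < W
  0<W = +-mono-≤-< (+-mono-≤ 0≤Y₂ 0≤z) 0<u0
  0<W' : 0ℚ < W'
  0<W' = +-mono-≤-< 0≤Y₂ 0<u0
  identity : W * D * W' * (a - rev * z) ≡ W * D * ((rev - rev') * (D' * D')) + z * X₁ * D * (A₁ - rev * X₁)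
  identity = removal-identity₂ u0 X₁ A₁ Y₂ B₂ z a rev rev'
    (revenue-cleared u0 X₁ A₁ (Y₂ + z) (B₂ + a) 0<D) (revenue-cleared u0 X₁ A₁ Y₂ B₂ 0<D')
  0≤gap : 0ℚ ≤ W * D * ((rev - rev') * (D' * D')) + z * X₁ * D * (A₁ - rev * X₁)
  0≤gap = +-mono-≤ (0≤* (0≤* (<⇒≤ 0<W) (<⇒≤ 0<D)) (0≤* (p≤q⇒0≤q-p rev'≤rev) (0≤* (<⇒≤ 0<D') (<⇒≤ 0<D'))))
                   (0≤* (0≤* (0≤* 0≤z 0≤X₁) (<⇒≤ 0<D)) (p≤q⇒0≤q-p revX₁≤A₁))

module _ {n} (lev : Fin n → Lvl) (u : Fin n → ℚ) (u0 : ℚ) (r : Fin n → ℚ) where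

  UR : Subset n → ℚ
  UR S = sumOver S (λ x → u x * r x)

  share : Subset n → Lvl → ℚ → ℚ
  share S L1 q = q ÷' (U u S + u0)
  share S L2 q = (1ℚ - U u (restrict lev L1 S) ÷' (U u S + u0)) * (q ÷' (U u S + u0))

  ρ*r≡share : ∀ S x → ρ lev u u0 S x * r x ≡ share S (lev x) (u x * r x)
  ρ*r≡share S x with lev x
  ... | L1 = ÷'-*-comm (u x) (U u S + u0) (r x)
  ... | L2 = trans (*-assoc k _ (r x)) (cong (k *_) (÷'-*-comm (u x) (U u S + u0) (r x)))
    where k = 1ℚ - U u (restrict lev L1 S) ÷' (U u S + u0)

  R-by-level : ∀ S → let S₁ = restrict lev L1 S; S₂ = restrict lev L2 S in
    R lev u u0 r S ≡ revenue u0 (U u S₁) (UR S₁) (U u S₂) (UR S₂)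
  R-by-level S = begin
    R lev u u0 r S
      ≡⟨ sumOver-cong S (ρ*r≡share S) ⟩
    sumOver S (λ x → share S (lev x) (u x * r x))
      ≡⟨ sumOver-by-level lev S (λ ℓ x → share S ℓ (u x * r x)) ⟩
    sumOver S₁ (λ x → (u x * r x) ÷' D) + sumOver S₂ (λ x → k * ((u x * r x) ÷' D))
      ≡⟨ cong₂ _+_ (sumOver-÷' S₁ D _) (trans (sumOver-*ˡ S₂ k _) (cong (k *_) (sumOver-÷' S₂ D _))) ⟩
    UR S₁ ÷' D + k * (UR S₂ ÷' D)
      ≡⟨ cong (λ d → UR S₁ ÷' d + (1ℚ - U u S₁ ÷' d) * (UR S₂ ÷' d)) (cong (_+ u0) (sumOver-by-level lev S (λ _ → u))) ⟩
    revenue u0 (U u S₁) (UR S₁) (U u S₂) (UR S₂) ∎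
    where
    S₁ = restrict lev L1 S
    S₂ = restrict lev L2 S
    D = U u S + u0
    k = 1ℚ - U u S₁ ÷' D

  module _ (0<u : ∀ x → 0ℚ < u x) (0<u0 : 0ℚ < u0) (0≤r : ∀ x → 0ℚ ≤ r x)
           (S : Subset n) (optimal : ∀ T → R lev u u0 r T ≤ R lev u u0 r S) where

    U-nonNeg : ∀ A → 0ℚ ≤ U u A
    U-nonNeg A = sumOver-nonNeg A (<⇒≤ ∘ 0<u)

    UR-nonNeg : ∀ A → 0ℚ ≤ UR A
    UR-nonNeg A = sumOver-nonNeg A (λ x → 0≤* (<⇒≤ (0<u x)) (0≤r x))

    removal-bound : ∀ ℓ {Z} → Z ⊆ restrict lev ℓ S → R lev u u0 r S * U u Z ≤ UR Z
    removal-bound L1 {Z} Z⊆S₁ =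
      subst (λ R* → R* * U u Z ≤ UR Z) (sym R≡)
        (revenue-removal₁ 0<u0 (U-nonNeg T₁) (U-nonNeg S₂) (UR-nonNeg S₂) (U-nonNeg Z)
          (subst₂ _≤_ R-removed≡ R≡ (optimal (S ─ Z))))
      where
      T₁ = restrict lev L1 (S ─ Z)
      S₂ = restrict lev L2 S
      R≡ : R lev u u0 r S ≡ revenue u0 (U u T₁ + U u Z) (UR T₁ + UR Z) (U u S₂) (UR S₂)
      R≡ = trans (R-by-level S) (cong₂ (λ X A → revenue u0 X A (U u S₂) (UR S₂))
        (sumOver-restrict-─ lev S u Z⊆S₁) (sumOver-restrict-─ lev S _ Z⊆S₁))
      R-removed≡ : R lev u u0 r (S ─ Z) ≡ revenue u0 (U u T₁) (UR T₁) (U u S₂) (UR S₂)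
      R-removed≡ = trans (R-by-level (S ─ Z)) (cong (λ A → revenue u0 (U u T₁) (UR T₁) (U u A) (UR A))
        (restrict-─-other lev S (λ ()) Z⊆S₁))
    removal-bound L2 {Z} Z⊆S₂ =
      subst (λ R* → R* * U u Z ≤ UR Z) (sym R≡)
        (revenue-removal₂ 0<u0 (U-nonNeg S₁) (U-nonNeg T₂) (U-nonNeg Z)
          (subst (λ R* → R* * U u S₁ ≤ UR S₁) R≡ (removal-bound L1 (λ x∈S₁ → x∈S₁)))
          (subst₂ _≤_ R-removed≡ R≡ (optimal (S ─ Z))))
      where
      T₂ = restrict lev L2 (S ─ Z)
      S₁ = restrict lev L1 S
      R≡ : R lev u u0 r S ≡ revenue u0 (U u S₁) (UR S₁) (U u T₂ + U u Z) (UR T₂ + UR Z)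
      R≡ = trans (R-by-level S) (cong₂ (λ X A → revenue u0 (U u S₁) (UR S₁) X A)
        (sumOver-restrict-─ lev S u Z⊆S₂) (sumOver-restrict-─ lev S _ Z⊆S₂))
      R-removed≡ : R lev u u0 r (S ─ Z) ≡ revenue u0 (U u S₁) (UR S₁) (U u T₂) (UR T₂)
      R-removed≡ = trans (R-by-level (S ─ Z)) (cong (λ A → revenue u0 (U u A) (UR A) (U u T₂) (UR T₂))
        (restrict-─-other lev S (λ ()) Z⊆S₂))

proposition5 : (n : ℕ) (lev : Fin n → Lvl) (u : Fin n → ℚ) (u0 : ℚ) (r : Fin n → ℚ) →
    (∀ x → 0ℚ < u x) → 0ℚ < u0 → (∀ x → 0ℚ ≤ r x) →
    (S* : Subset n) → (∀ (S : Subset n) → R lev u u0 r S ≤ R lev u u0 r S*) →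
    (i : Lvl) (Z : Subset n) → Nonempty Z → Z ⊆ restrict lev i S* →
    R lev u u0 r S* ≤ α u r Z
proposition5 n lev u u0 r 0<u 0<u0 0≤r S* optimal i Z nonempty Z⊆S*ᵢ =
  ≤-÷' (sumOver-pos Z 0<u nonempty) (removal-bound lev u u0 r 0<u 0<u0 0≤r S* optimal i Z⊆S*ᵢ)
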